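{- Let $a,b,c\in\mathbb{N}$ with $a\le b\le c$ and $2b>c$. Then $f(a,b,c)\ge\left\lfloor\frac{2}{3}(b+c-1)\right\rfloor$.
   Context: $\mathbb{N}$ denotes the positive integers and $[n]=\{1,\dots,n\}$. For $a,b,c\in\mathbb{N}$, $f(a,b,c)$ denotes the metric dimension of the Cartesian product $K_a\times K_b\times K_c$ of complete graphs (vertex set $[a]\times[b]\times[c]$, two triples adjacent iff they differ in exactly one coordinate); the metric dimension of a graph is the minimum size of a vertex set $U$ such that every vertex is uniquely determined by its vector of distances to the vertices of $U$. -}

module Defs where

open import Level using (0ℓ)
open import Data.Nat using (ℕ; zero; suc; _<_; _≤_)
open import Data.Fin using (Fin)
open import Data.Product using (_×_; Σ; ∃; _,_)
open import Data.Sum using (_⊎_)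
open import Data.List using (List; length)
open import Data.List.Membership.Propositional using (_∈_)
open import Data.List.Relation.Unary.Unique.Propositional using (Unique)
open import Relation.Binary.PropositionalEquality using (_≡_; _≢_)
open import Relation.Nullary using (¬_)

data Walk {V : Set} (Adj : V → V → Set) : ℕ → V → V → Set where
  here : ∀ {x} → Walk Adj zero x x
  step : ∀ {n x y z} → Adj x y → Walk Adj n y z → Walk Adj (suc n) x z

IsDist : {V : Set} (Adj : V → V → Set) → V → V → ℕ → Set
IsDist Adj x y n = Walk Adj n x y × (∀ m → m < n → ¬ Walk Adj m x y)

Resolving : {V : Set} (Adj : V → V → Set) → List V → Set
Resolving {V} Adj U =
  ∀ (x y : V) → (∀ u → u ∈ U → ∀ n → (IsDist Adj x u n → IsDist Adj y u n)
                                     × (IsDist Adj y u n → IsDist Adj x u n))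
              → x ≡ y

IsMetricDimension : {V : Set} (Adj : V → V → Set) → ℕ → Set
IsMetricDimension {V} Adj d =
  (Σ (List V) λ U → Unique U × Resolving Adj U × length U ≡ d)
  × (∀ (U : List V) → Unique U → Resolving Adj U → d ≤ length U)

-- The Cartesian product K_a × K_b × K_c: vertex set [a]×[b]×[c],
-- two triples adjacent iff they differ in exactly one coordinate.
Vtx : ℕ → ℕ → ℕ → Set
Vtx a b c = Fin a × Fin b × Fin c

KKK-Adj : (a b c : ℕ) → Vtx a b c → Vtx a b c → Set
KKK-Adj a b c (x₁ , x₂ , x₃) (y₁ , y₂ , y₃) =
    (x₁ ≢ y₁ × x₂ ≡ y₂ × x₃ ≡ y₃)
  ⊎ (x₁ ≡ y₁ × x₂ ≢ y₂ × x₃ ≡ y₃)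
  ⊎ (x₁ ≡ y₁ × x₂ ≡ y₂ × x₃ ≢ y₃)

-- Distances in K_a × K_b × K_c are Hamming distances. Fixing the first coordinate,
-- a resolving set U of size d therefore projects to d points of the b × c grid that
-- resolve every pair of grid points (the first coordinate adds the same amount to
-- both distances). Call a row or column empty or singleton if it carries 0 or 1 of
-- these points, and a point lonely if it is alone in both its row and its column.
-- Twins rule out the configurations that would break the count: two empty rows y, y′
-- make (y, z) and (y′, z) twins; two lonely points u, v make the other corners
-- (u₁, v₂), (v₁, u₂) of their rectangle twins; an empty row y, an empty column z and
-- a lonely point u make (u₁, z), (y, u₂) twins. So 2·#empty rows + 2·#empty columns +
-- #lonely ≤ 4. Counting rows, 2b ≤ d + 2·#empty rows + #singleton rows, likewise for
-- columns, and a point lies in a singleton row and a singleton column only if it is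
-- lonely; adding up, 2(b + c) ≤ 3d + 4.
module Submission where

open import Algebra.Properties.CommutativeSemigroup using (interchange)
open import Data.Bool.Base using (if_then_else_)
open import Data.Empty using (⊥-elim)
open import Data.Fin.Base using (Fin; zero; suc; fromℕ<; punchOut)
open import Data.Fin.Instances
open import Data.Fin.Properties using (0≢1+n; suc-injective; punchIn-punchOut)
open import Data.List.Base using (List; lookup; length)
open import Data.List.Membership.Propositional using (_∈_)
open import Data.List.Relation.Unary.Any using (index)
open import Data.List.Relation.Unary.Any.Properties using (lookup-index)
open import Data.Nat.Base using (ℕ; zero; suc; _+_; _*_; _∸_; _/_; _≤_; _<_; z≤n; s≤s)
open import Data.Nat.DivMod using (m<n*o⇒m/o<n)
open import Data.Nat.Instances
open import Data.Nat.Properties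
  using ( +-*-semiring; +-commutativeSemigroup; +-comm; +-identityʳ; *-identityʳ; *-zeroʳ
        ; *-comm; *-suc; *-distribˡ-+; ≤-refl; ≤-reflexive; ≤-trans; ≤-antisym; +-mono-≤
        ; +-monoʳ-≤; *-monoʳ-≤; +-cancelˡ-≤; m≤m+n; n≤1+n; n<1+n; m<1+n⇒m≤n; n≮0; n≮n
        ; <⇒≱; ≮⇒≥; module ≤-Reasoning)
open import Data.Nat.Tactic.RingSolver using (solve-∀)
open import Data.Product.Base as Product using (_×_; _,_; ∃; proj₁; proj₂)
open import Data.Sum.Base using (_⊎_; inj₁; inj₂)
open import Data.Vec.Functional using (Vector; removeAt)
open import Function.Base using (_∘_; id)
open import Level using (0ℓ)
open import Relation.Binary.PropositionalEquality
  using (_≡_; _≢_; refl; sym; trans; subst; cong; cong₂; module ≡-Reasoning)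
open import Relation.Binary.TypeClasses using (_≟_)
open import Relation.Nullary using (Dec; yes; no; does; ¬_; ¬?; _×-dec_; _⊎-dec_; contradiction)
open import Relation.Unary using (Pred; Decidable)

open import Algebra.Properties.Semiring.Sum +-*-semiring
  using ( sum; sum-syntax; sum-cong-≗; sum-remove; sum-replicate-zero; ∑-comm; ∑-distrib-+
        ; *-distribˡ-sum; *-distribʳ-sum)

open import Defs

+-interchange : ∀ w x y z → (w + x) + (y + z) ≡ (w + y) + (x + z)
+-interchange = interchange +-commutativeSemigroup

[_] : ∀ {a} {A : Set a} → Dec A → ℕ
[ a? ] = if does a? then 1 else 0

module _ {a} {A : Set a} where

  []-yes : (a? : Dec A) → A → [ a? ] ≡ 1
  []-yes (yes _) _ = refl
  []-yes (no ¬a) a = contradiction a ¬a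

  []-no : (a? : Dec A) → ¬ A → [ a? ] ≡ 0
  []-no (yes a) ¬a = contradiction a ¬a
  []-no (no _) _ = refl

  []≤1 : (a? : Dec A) → [ a? ] ≤ 1
  []≤1 (yes _) = s≤s z≤n
  []≤1 (no _) = z≤n

[]+[]≤1+[×] : ∀ {a b} {A : Set a} {B : Set b} (a? : Dec A) (b? : Dec B) →
              [ a? ] + [ b? ] ≤ 1 + [ a? ×-dec b? ]
[]+[]≤1+[×] (yes _) (yes _) = ≤-refl
[]+[]≤1+[×] (yes _) (no _) = ≤-refl
[]+[]≤1+[×] (no _) (yes _) = ≤-refl
[]+[]≤1+[×] (no _) (no _) = z≤n

∑-const : ∀ n k → ∑[ _ < n ] k ≡ n * k
∑-const zero k = refl
∑-const (suc n) k = cong (k +_) (∑-const n k)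

∑-mono-≤ : ∀ {n} {f g : Vector ℕ n} → (∀ i → f i ≤ g i) → sum f ≤ sum g
∑-mono-≤ {zero} f≤g = z≤n
∑-mono-≤ {suc n} f≤g = +-mono-≤ (f≤g zero) (∑-mono-≤ (f≤g ∘ suc))

term≤∑ : ∀ {n} (t : Vector ℕ n) i → t i ≤ sum t
term≤∑ {suc n} t i = ≤-trans (m≤m+n (t i) _) (≤-reflexive (sym (sum-remove {i = i} t)))

term+term≤∑ : ∀ {n} (t : Vector ℕ n) {i j} → i ≢ j → t i + t j ≤ sum t
term+term≤∑ {suc n} t {i} {j} i≢j = begin
  t i + t j                           ≡⟨ cong (λ k → t i + t k) (punchIn-punchOut i≢j) ⟨
  t i + removeAt t i (punchOut i≢j)   ≤⟨ +-monoʳ-≤ (t i) (term≤∑ (removeAt t i) _) ⟩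
  t i + sum (removeAt t i)            ≡⟨ sum-remove {i = i} t ⟨
  sum t                               ∎
  where open ≤-Reasoning

∑-select : ∀ {n} (x : Fin n) (g : Vector ℕ n) → ∑[ y < n ] ([ x ≟ y ] * g y) ≡ g x
∑-select {suc n} zero g =
  trans (cong₂ _+_ (+-identityʳ (g zero)) (sum-replicate-zero n)) (+-identityʳ (g zero))
∑-select {suc n} (suc x) g = ∑-select x (g ∘ suc)

module _ {p n} {P : Pred (Fin n) p} (P? : Decidable P) where

  []≤∑[] : ∀ {x} → P x → 1 ≤ ∑[ y < n ] [ P? y ]
  []≤∑[] {x} px = subst (_≤ _) ([]-yes (P? x) px) (term≤∑ (λ y → [ P? y ]) x)

  ∑[]≡0⇒¬ : ∑[ x < n ] [ P? x ] ≡ 0 → ∀ {x} → ¬ P x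
  ∑[]≡0⇒¬ ∑≡0 px = n≮0 (subst (1 ≤_) ∑≡0 ([]≤∑[] px))

  ∑[]≡1⇒unique : ∑[ x < n ] [ P? x ] ≡ 1 → ∀ {x y} → P x → P y → x ≡ y
  ∑[]≡1⇒unique ∑≡1 {x} {y} px py with x ≟ y
  ... | yes x≡y = x≡y
  ... | no x≢y = contradiction (subst (2 ≤_) ∑≡1 2≤∑) (n≮n 1)
    where
    2≤∑ : 2 ≤ ∑[ z < n ] [ P? z ]
    2≤∑ = subst (_≤ ∑[ z < n ] [ P? z ]) (cong₂ _+_ ([]-yes (P? x) px) ([]-yes (P? y) py))
                (term+term≤∑ (λ z → [ P? z ]) x≢y)

∑[]≤1 : ∀ {p n} {P : Pred (Fin n) p} (P? : Decidable P) →
        (∀ {x y} → P x → P y → x ≡ y) → ∑[ x < n ] [ P? x ] ≤ 1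
∑[]≤1 {n = zero} P? unique = z≤n
∑[]≤1 {n = suc n} P? unique with P? zero
... | yes p₀ = ≤-reflexive (cong suc (trans
        (sum-cong-≗ (λ x → []-no (P? (suc x)) (0≢1+n ∘ unique p₀))) (sum-replicate-zero n)))
... | no _ = ∑[]≤1 (P? ∘ suc) (λ px py → suc-injective (unique px py))

∑[]-witness : ∀ {p n} {P : Pred (Fin n) p} (P? : Decidable P) → 0 < ∑[ x < n ] [ P? x ] → ∃ P
∑[]-witness {n = suc n} P? ∑>0 with P? zero
... | yes p₀ = zero , p₀
... | no _ = Product.map suc id (∑[]-witness (P? ∘ suc) ∑>0)

module _ {d n : ℕ} (h : Fin d → Fin n) where

  fibreSize : Fin n → ℕ
  fibreSize y = ∑[ i < d ] [ h i ≟ y ]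

  emptyFibres singletonFibres : ℕ
  emptyFibres = ∑[ y < n ] [ fibreSize y ≟ 0 ]
  singletonFibres = ∑[ y < n ] [ fibreSize y ≟ 1 ]

  fibreSize≡0⇒∉ : ∀ {y} → fibreSize y ≡ 0 → ∀ {i} → h i ≢ y
  fibreSize≡0⇒∉ {y} = ∑[]≡0⇒¬ (λ i → h i ≟ y)

  fibreSize≡1⇒unique : ∀ {y} → fibreSize y ≡ 1 → ∀ {i j} → h i ≡ y → h j ≡ y → i ≡ j
  fibreSize≡1⇒unique {y} = ∑[]≡1⇒unique (λ i → h i ≟ y)

  ∑-fibreSize-* : (g : Vector ℕ n) → ∑[ y < n ] (fibreSize y * g y) ≡ ∑[ i < d ] g (h i)
  ∑-fibreSize-* g = begin
    ∑[ y < n ] (fibreSize y * g y)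
      ≡⟨ sum-cong-≗ (λ y → *-distribʳ-sum (g y) (λ i → [ h i ≟ y ])) ⟩
    ∑[ y < n ] ∑[ i < d ] ([ h i ≟ y ] * g y) ≡⟨ ∑-comm (λ y i → [ h i ≟ y ] * g y) ⟩
    ∑[ i < d ] ∑[ y < n ] ([ h i ≟ y ] * g y) ≡⟨ sum-cong-≗ (λ i → ∑-select (h i) g) ⟩
    ∑[ i < d ] g (h i)                         ∎
    where open ≡-Reasoning

  ∑-fibreSize : ∑[ y < n ] fibreSize y ≡ d
  ∑-fibreSize = begin
    ∑[ y < n ] fibreSize y       ≡⟨ sum-cong-≗ (λ y → *-identityʳ (fibreSize y)) ⟨
    ∑[ y < n ] (fibreSize y * 1) ≡⟨ ∑-fibreSize-* (λ _ → 1) ⟩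
    ∑[ i < d ] 1                 ≡⟨ ∑-const d 1 ⟩
    d * 1                        ≡⟨ *-identityʳ d ⟩
    d                            ∎
    where open ≡-Reasoning

  singletonFibres≡∑entries : singletonFibres ≡ ∑[ i < d ] [ fibreSize (h i) ≟ 1 ]
  singletonFibres≡∑entries =
    trans (sum-cong-≗ (λ y → [k≡1]≡k*[k≡1] (fibreSize y))) (∑-fibreSize-* (λ y → [ fibreSize y ≟ 1 ]))
    where
    [k≡1]≡k*[k≡1] : ∀ k → [ k ≟ 1 ] ≡ k * [ k ≟ 1 ]
    [k≡1]≡k*[k≡1] 0 = refl
    [k≡1]≡k*[k≡1] 1 = refl
    [k≡1]≡k*[k≡1] (suc (suc k)) = sym (*-zeroʳ (suc (suc k)))

  2*n≤d+2*emptyFibres+singletonFibres : 2 * n ≤ d + 2 * emptyFibres + singletonFibres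
  2*n≤d+2*emptyFibres+singletonFibres = begin
    2 * n                  ≡⟨ trans (*-comm 2 n) (sym (∑-const n 2)) ⟩
    ∑[ y < n ] 2           ≤⟨ ∑-mono-≤ (λ y → 2≤k+2[k≡0]+[k≡1] (fibreSize y)) ⟩
    ∑[ y < n ] (fibreSize y + 2 * [ fibreSize y ≟ 0 ] + [ fibreSize y ≟ 1 ])
      ≡⟨ ∑-distrib-+ (λ y → fibreSize y + 2 * [ fibreSize y ≟ 0 ]) (λ y → [ fibreSize y ≟ 1 ]) ⟩
    ∑[ y < n ] (fibreSize y + 2 * [ fibreSize y ≟ 0 ]) + singletonFibres
      ≡⟨ cong (_+ singletonFibres) (∑-distrib-+ fibreSize (λ y → 2 * [ fibreSize y ≟ 0 ])) ⟩
    ∑[ y < n ] fibreSize y + ∑[ y < n ] (2 * [ fibreSize y ≟ 0 ]) + singletonFibres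
      ≡⟨ cong₂ (λ s t → s + t + singletonFibres)
               ∑-fibreSize (sym (*-distribˡ-sum 2 (λ y → [ fibreSize y ≟ 0 ]))) ⟩
    d + 2 * emptyFibres + singletonFibres ∎
    where
    open ≤-Reasoning
    2≤k+2[k≡0]+[k≡1] : ∀ k → 2 ≤ k + 2 * [ k ≟ 0 ] + [ k ≟ 1 ]
    2≤k+2[k≡0]+[k≡1] 0 = ≤-refl
    2≤k+2[k≡0]+[k≡1] 1 = ≤-refl
    2≤k+2[k≡0]+[k≡1] (suc (suc k)) = m≤m+n 2 _

δ : ∀ {n} → Fin n → Fin n → ℕ
δ x y = [ ¬? (x ≟ y) ]

module _ {n : ℕ} where

  δ-refl : (x : Fin n) → δ x x ≡ 0
  δ-refl x = []-no (¬? (x ≟ x)) (λ x≢x → x≢x refl)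

  δ-≢ : {x y : Fin n} → x ≢ y → δ x y ≡ 1
  δ-≢ {x} {y} = []-yes (¬? (x ≟ y))

  δ≤1 : (x y : Fin n) → δ x y ≤ 1
  δ≤1 x y = []≤1 (¬? (x ≟ y))

  δ-avoid : ∀ {y y′ w : Fin n} → w ≢ y → w ≢ y′ → δ y w ≡ δ y′ w
  δ-avoid w≢y w≢y′ = trans (δ-≢ (w≢y ∘ sym)) (sym (δ-≢ (w≢y′ ∘ sym)))

  δ-triangle : (x y z : Fin n) → δ x z ≤ δ x y + δ y z
  δ-triangle x y z with x ≟ z | x ≟ y
  ... | yes _ | _ = z≤n
  ... | no _ | no _ = s≤s z≤n
  ... | no x≢z | yes refl = ≤-reflexive (sym (δ-≢ x≢z))

hamming₂ : ∀ {b c} → Fin b × Fin c → Fin b × Fin c → ℕ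
hamming₂ (y , z) (y′ , z′) = δ y y′ + δ z z′

hamming : ∀ {a b c} → Vtx a b c → Vtx a b c → ℕ
hamming (x , p) (x′ , p′) = δ x x′ + hamming₂ p p′

hamming₂-triangle : ∀ {b c} (p q r : Fin b × Fin c) → hamming₂ p r ≤ hamming₂ p q + hamming₂ q r
hamming₂-triangle (y , z) (y′ , z′) (y″ , z″) = ≤-trans
  (+-mono-≤ (δ-triangle y y′ y″) (δ-triangle z z′ z″))
  (≤-reflexive (+-interchange (δ y y′) (δ y′ y″) (δ z z′) (δ z′ z″)))

hamming-triangle : ∀ {a b c} (x y z : Vtx a b c) → hamming x z ≤ hamming x y + hamming y z
hamming-triangle (x , p) (y , q) (z , r) = ≤-trans
  (+-mono-≤ (δ-triangle x y z) (hamming₂-triangle p q r))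
  (≤-reflexive (+-interchange (δ x y) (δ y z) (hamming₂ p q) (hamming₂ q r)))

_++ʷ_ : ∀ {V : Set} {Adj : V → V → Set} {m n x y z} →
        Walk Adj m x y → Walk Adj n y z → Walk Adj (m + n) x z
here ++ʷ w = w
step e v ++ʷ w = step e (v ++ʷ w)

module _ {a b c : ℕ} where

  private
    Adj = KKK-Adj a b c

  hamming-refl : (x : Vtx a b c) → hamming x x ≡ 0
  hamming-refl (x₁ , x₂ , x₃) = cong₂ _+_ (δ-refl x₁) (cong₂ _+_ (δ-refl x₂) (δ-refl x₃))

  adj⇒hamming≤1 : ∀ {x y} → Adj x y → hamming x y ≤ 1
  adj⇒hamming≤1 {x₁ , x₂ , x₃} {y₁ , _ , _} (inj₁ (_ , refl , refl)) =
    +-mono-≤ (δ≤1 x₁ y₁) (≤-reflexive (cong₂ _+_ (δ-refl x₂) (δ-refl x₃)))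
  adj⇒hamming≤1 {x₁ , x₂ , x₃} {_ , y₂ , _} (inj₂ (inj₁ (refl , _ , refl))) =
    +-mono-≤ (≤-reflexive (δ-refl x₁)) (+-mono-≤ (δ≤1 x₂ y₂) (≤-reflexive (δ-refl x₃)))
  adj⇒hamming≤1 {x₁ , x₂ , x₃} {_ , _ , y₃} (inj₂ (inj₂ (refl , refl , _))) =
    +-mono-≤ (≤-reflexive (δ-refl x₁)) (+-mono-≤ (≤-reflexive (δ-refl x₂)) (δ≤1 x₃ y₃))

  walk⇒hamming≤ : ∀ {m x y} → Walk Adj m x y → hamming x y ≤ m
  walk⇒hamming≤ {x = x} here = ≤-reflexive (hamming-refl x)
  walk⇒hamming≤ {x = x} {z} (step {y = y} x~y w) =
    ≤-trans (hamming-triangle x y z) (+-mono-≤ (adj⇒hamming≤1 x~y) (walk⇒hamming≤ w))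

  δ-walk : ∀ {n} (f : Fin n → Vtx a b c) → (∀ {s t} → s ≢ t → Adj (f s) (f t)) →
           ∀ s t → Walk Adj (δ s t) (f s) (f t)
  δ-walk f adj s t = walk (s ≟ t)
    where
    walk : (s≟t : Dec (s ≡ t)) → Walk Adj [ ¬? s≟t ] (f s) (f t)
    walk (yes refl) = here
    walk (no s≢t) = step (adj s≢t) here

  hamming-walk : ∀ x y → Walk Adj (hamming x y) x y
  hamming-walk (x₁ , x₂ , x₃) (y₁ , y₂ , y₃) =
    δ-walk (λ s → s , x₂ , x₃) (λ s≢t → inj₁ (s≢t , refl , refl)) x₁ y₁ ++ʷ
    (δ-walk (λ s → y₁ , s , x₃) (λ s≢t → inj₂ (inj₁ (refl , s≢t , refl))) x₂ y₂ ++ʷ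
     δ-walk (λ s → y₁ , y₂ , s) (λ s≢t → inj₂ (inj₂ (refl , refl , s≢t))) x₃ y₃)

  isDist-hamming : ∀ x y → IsDist Adj x y (hamming x y)
  isDist-hamming x y = hamming-walk x y , λ m m<h w → <⇒≱ m<h (walk⇒hamming≤ w)

  isDist⇒≡hamming : ∀ {x y n} → IsDist Adj x y n → n ≡ hamming x y
  isDist⇒≡hamming {x} {y} (w , shortest) =
    ≤-antisym (≮⇒≥ (λ h<n → shortest _ h<n (hamming-walk x y))) (walk⇒hamming≤ w)

  resolving⇒hamming-injective : ∀ {U} → Resolving Adj U → ∀ {x y} →
                                (∀ u → u ∈ U → hamming x u ≡ hamming y u) → x ≡ y
  resolving⇒hamming-injective resolving {x} {y} same =
    resolving x y λ u u∈U n → transport (same u u∈U) , transport (sym (same u u∈U))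
    where
    transport : ∀ {x y u n} → hamming x u ≡ hamming y u → IsDist Adj x u n → IsDist Adj y u n
    transport {y = y} {u} x≈y dist =
      subst (IsDist Adj y u) (sym (trans (isDist⇒≡hamming dist) x≈y)) (isDist-hamming y u)

-- The points p i need not be distinct: a resolving set may project non-injectively.
Separating : ∀ {b c d} → (Fin d → Fin b × Fin c) → Set
Separating p = ∀ s t → (∀ i → hamming₂ s (p i) ≡ hamming₂ t (p i)) → s ≡ t

resolving⇒layer-separating : ∀ {a b c} {U : List (Vtx a b c)} → Fin a →
                             Resolving (KKK-Adj a b c) U → Separating (proj₂ ∘ lookup U)
resolving⇒layer-separating {U = U} x resolving s t same =
  cong proj₂ (resolving⇒hamming-injective resolving {x , s} {x , t} λ u u∈U →
    cong (δ x (proj₁ u) +_) (subst (λ v → hamming₂ s (proj₂ v) ≡ hamming₂ t (proj₂ v))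
                                   (sym (lookup-index u∈U)) (same (index u∈U))))

rectangle-twins : ∀ {b c} {y y′ : Fin b} {z z′ : Fin c} → y ≢ y′ → z ≢ z′ → (w : Fin b × Fin c) →
                  (proj₁ w ≡ y ⊎ proj₂ w ≡ z′ → w ≡ (y , z′)) →
                  (proj₁ w ≡ y′ ⊎ proj₂ w ≡ z → w ≡ (y′ , z)) →
                  hamming₂ (y , z) w ≡ hamming₂ (y′ , z′) w
rectangle-twins {y = y} {y′} {z} {z′} y≢y′ z≢z′ (w₁ , w₂) onU onV
  with (w₁ ≟ y) ⊎-dec (w₂ ≟ z′) | (w₁ ≟ y′) ⊎-dec (w₂ ≟ z)
... | yes touchesU | _ with refl ← onU touchesU =
  trans (cong₂ _+_ (δ-refl y) (δ-≢ z≢z′)) (sym (cong₂ _+_ (δ-≢ (y≢y′ ∘ sym)) (δ-refl z′)))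
... | no _ | yes touchesV with refl ← onV touchesV =
  trans (cong₂ _+_ (δ-≢ y≢y′) (δ-refl z)) (sym (cong₂ _+_ (δ-refl y′) (δ-≢ (z≢z′ ∘ sym))))
... | no avoidsU | no avoidsV =
  trans (cong₂ _+_ (δ-≢ (avoidsU ∘ inj₁ ∘ sym)) (δ-≢ (avoidsV ∘ inj₂ ∘ sym)))
        (sym (cong₂ _+_ (δ-≢ (avoidsV ∘ inj₁ ∘ sym)) (δ-≢ (avoidsU ∘ inj₂ ∘ sym))))

module Grid {b c d : ℕ} (p : Fin d → Fin b × Fin c) (separating : Separating p)
            (y₀ : Fin b) (z₀ : Fin c) where

  row : Fin d → Fin b
  row = proj₁ ∘ p

  col : Fin d → Fin c
  col = proj₂ ∘ p

  Lonely : Pred (Fin d) 0ℓ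
  Lonely i = fibreSize row (row i) ≡ 1 × fibreSize col (col i) ≡ 1

  lonely? : Decidable Lonely
  lonely? i = (fibreSize row (row i) ≟ 1) ×-dec (fibreSize col (col i) ≟ 1)

  lonelyEntries : ℕ
  lonelyEntries = ∑[ i < d ] [ lonely? i ]

  emptyRow-unique : ∀ {y y′} → fibreSize row y ≡ 0 → fibreSize row y′ ≡ 0 → y ≡ y′
  emptyRow-unique {y} {y′} empty empty′ = cong proj₁ (separating (y , z₀) (y′ , z₀) λ i →
    cong (_+ δ z₀ (col i)) (δ-avoid (fibreSize≡0⇒∉ row empty) (fibreSize≡0⇒∉ row empty′)))

  emptyCol-unique : ∀ {z z′} → fibreSize col z ≡ 0 → fibreSize col z′ ≡ 0 → z ≡ z′
  emptyCol-unique {z} {z′} empty empty′ = cong proj₂ (separating (y₀ , z) (y₀ , z′) λ i →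
    cong (δ y₀ (row i) +_) (δ-avoid (fibreSize≡0⇒∉ col empty) (fibreSize≡0⇒∉ col empty′)))

  lonely-isolated : ∀ {i k} → Lonely i → row k ≡ row i ⊎ col k ≡ col i → p k ≡ p i
  lonely-isolated (rowSingleton , _) (inj₁ sameRow) =
    cong p (fibreSize≡1⇒unique row rowSingleton sameRow refl)
  lonely-isolated (_ , colSingleton) (inj₂ sameCol) =
    cong p (fibreSize≡1⇒unique col colSingleton sameCol refl)

  lonely-unique : ∀ {i j} → Lonely i → Lonely j → i ≡ j
  lonely-unique {i} {j} lonelyᵢ lonelyⱼ with row i ≟ row j | col j ≟ col i
  ... | yes sameRow | _ = fibreSize≡1⇒unique row (proj₁ lonelyⱼ) sameRow refl
  ... | _ | yes sameCol = sym (fibreSize≡1⇒unique col (proj₂ lonelyᵢ) sameCol refl)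
  ... | no rowᵢ≢rowⱼ | no colⱼ≢colᵢ = contradiction
    (cong proj₁ (separating (row i , col j) (row j , col i) λ k →
      rectangle-twins rowᵢ≢rowⱼ colⱼ≢colᵢ (p k) (lonely-isolated lonelyᵢ) (lonely-isolated lonelyⱼ)))
    rowᵢ≢rowⱼ

  emptyRow-emptyCol-¬lonely : ∀ {y z i} → fibreSize row y ≡ 0 → fibreSize col z ≡ 0 → ¬ Lonely i
  emptyRow-emptyCol-¬lonely {y} {z} {i} emptyRow emptyCol lonelyᵢ = contradiction
    (cong proj₁ (separating (row i , z) (y , col i) λ k →
      rectangle-twins rowᵢ≢y (fibreSize≡0⇒∉ col emptyCol ∘ sym) (p k)
                      (lonely-isolated lonelyᵢ) (⊥-elim ∘ avoids k)))
    rowᵢ≢y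
    where
    rowᵢ≢y : row i ≢ y
    rowᵢ≢y = fibreSize≡0⇒∉ row emptyRow
    avoids : ∀ k → ¬ (row k ≡ y ⊎ col k ≡ z)
    avoids k (inj₁ rowₖ≡y) = fibreSize≡0⇒∉ row emptyRow rowₖ≡y
    avoids k (inj₂ colₖ≡z) = fibreSize≡0⇒∉ col emptyCol colₖ≡z

  2*emptyRows+2*emptyCols+lonelyEntries≤4 :
    2 * emptyFibres row + 2 * emptyFibres col + lonelyEntries ≤ 4
  2*emptyRows+2*emptyCols+lonelyEntries≤4 = 2e+2f+l≤4
    (∑[]≤1 (λ y → fibreSize row y ≟ 0) emptyRow-unique)
    (∑[]≤1 (λ z → fibreSize col z ≟ 0) emptyCol-unique)
    (∑[]≤1 lonely? lonely-unique)
    λ (emptyRows≡1 , emptyCols≡1 , lonelyEntries≡1) →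
      let _ , emptyRow = ∑[]-witness (λ y → fibreSize row y ≟ 0) (≤-reflexive (sym emptyRows≡1))
          _ , emptyCol = ∑[]-witness (λ z → fibreSize col z ≟ 0) (≤-reflexive (sym emptyCols≡1))
          _ , lonelyᵢ = ∑[]-witness lonely? (≤-reflexive (sym lonelyEntries≡1))
      in emptyRow-emptyCol-¬lonely emptyRow emptyCol lonelyᵢ
    where
    2e+2f+l≤4 : ∀ {e f l} → e ≤ 1 → f ≤ 1 → l ≤ 1 → ¬ (e ≡ 1 × f ≡ 1 × l ≡ 1) →
                2 * e + 2 * f + l ≤ 4
    2e+2f+l≤4 (s≤s z≤n) (s≤s z≤n) (s≤s z≤n) notAll = contradiction (refl , refl , refl) notAll
    2e+2f+l≤4 z≤n f≤1 l≤1 _ = ≤-trans (+-mono-≤ (*-monoʳ-≤ 2 f≤1) l≤1) (n≤1+n 3)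
    2e+2f+l≤4 (s≤s z≤n) z≤n l≤1 _ = +-monoʳ-≤ 2 (≤-trans l≤1 (s≤s z≤n))
    2e+2f+l≤4 (s≤s z≤n) (s≤s z≤n) z≤n _ = ≤-refl

  singletonRows+singletonCols≤d+lonelyEntries :
    singletonFibres row + singletonFibres col ≤ d + lonelyEntries
  singletonRows+singletonCols≤d+lonelyEntries = begin
    singletonFibres row + singletonFibres col
      ≡⟨ cong₂ _+_ (singletonFibres≡∑entries row) (singletonFibres≡∑entries col) ⟩
    ∑[ i < d ] [ rowSingleton? i ] + ∑[ i < d ] [ colSingleton? i ]
      ≡⟨ ∑-distrib-+ (λ i → [ rowSingleton? i ]) (λ i → [ colSingleton? i ]) ⟨
    ∑[ i < d ] ([ rowSingleton? i ] + [ colSingleton? i ])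
      ≤⟨ ∑-mono-≤ (λ i → []+[]≤1+[×] (rowSingleton? i) (colSingleton? i)) ⟩
    ∑[ i < d ] (1 + [ lonely? i ])
      ≡⟨ ∑-distrib-+ (λ _ → 1) (λ i → [ lonely? i ]) ⟩
    ∑[ i < d ] 1 + lonelyEntries
      ≡⟨ cong (_+ lonelyEntries) (trans (∑-const d 1) (*-identityʳ d)) ⟩
    d + lonelyEntries ∎
    where
    open ≤-Reasoning
    rowSingleton? : ∀ i → Dec (fibreSize row (row i) ≡ 1)
    rowSingleton? i = fibreSize row (row i) ≟ 1
    colSingleton? : ∀ i → Dec (fibreSize col (col i) ≡ 1)
    colSingleton? i = fibreSize col (col i) ≟ 1

  2[b+c]≤3d+4 : 2 * (b + c) ≤ 3 * d + 4
  2[b+c]≤3d+4 = begin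
    2 * (b + c)                              ≡⟨ *-distribˡ-+ 2 b c ⟩
    2 * b + 2 * c                            ≤⟨ +-mono-≤ (2*n≤d+2*emptyFibres+singletonFibres row)
                                                         (2*n≤d+2*emptyFibres+singletonFibres col) ⟩
    (d + 2 * eR + sR) + (d + 2 * eC + sC)    ≡⟨ regroup d eR eC sR sC ⟩
    (d + d + (2 * eR + 2 * eC)) + (sR + sC)  ≤⟨ +-monoʳ-≤ (d + d + (2 * eR + 2 * eC))
                                                          singletonRows+singletonCols≤d+lonelyEntries ⟩
    (d + d + (2 * eR + 2 * eC)) + (d + L)    ≡⟨ regroup′ d eR eC L ⟩
    3 * d + (2 * eR + 2 * eC + L)            ≤⟨ +-monoʳ-≤ (3 * d) 2*emptyRows+2*emptyCols+lonelyEntries≤4 ⟩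
    3 * d + 4                                ∎
    where
    open ≤-Reasoning
    eR = emptyFibres row
    eC = emptyFibres col
    sR = singletonFibres row
    sC = singletonFibres col
    L = lonelyEntries
    regroup : ∀ d e f s t → (d + 2 * e + s) + (d + 2 * f + t) ≡ (d + d + (2 * e + 2 * f)) + (s + t)
    regroup = solve-∀
    regroup′ : ∀ d e f l → (d + d + (2 * e + 2 * f)) + (d + l) ≡ 3 * d + (2 * e + 2 * f + l)
    regroup′ = solve-∀

2[b+c∸1]/3≤ : ∀ {b c d} → 1 ≤ b → 2 * (b + c) ≤ 3 * d + 4 → 2 * (b + c ∸ 1) / 3 ≤ d
2[b+c∸1]/3≤ {suc b} {c} {d} _ bound = m<1+n⇒m≤n (m<n*o⇒m/o<n (begin-strict
  2 * (b + c)  ≤⟨ +-cancelˡ-≤ 2 _ _ 2+2[b+c]≤4+3d ⟩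
  2 + 3 * d    <⟨ n<1+n _ ⟩
  3 + 3 * d    ≡⟨ cong (3 +_) (*-comm 3 d) ⟩
  suc d * 3    ∎))
  where
  open ≤-Reasoning
  2+2[b+c]≤4+3d : 2 + 2 * (b + c) ≤ 4 + 3 * d
  2+2[b+c]≤4+3d = begin
    2 + 2 * (b + c)  ≡⟨ *-suc 2 (b + c) ⟨
    2 * suc (b + c)  ≤⟨ bound ⟩
    3 * d + 4        ≡⟨ +-comm (3 * d) 4 ⟩
    4 + 3 * d        ∎

lemma5 : (a b c : ℕ) → 1 ≤ a → a ≤ b → b ≤ c → c < 2 * b →
    (d : ℕ) → IsMetricDimension (KKK-Adj a b c) d →
    (2 * (b + c ∸ 1)) / 3 ≤ d
lemma5 a b c 1≤a a≤b b≤c _ d ((U , _ , resolving , |U|≡d) , _) =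
  subst (2 * (b + c ∸ 1) / 3 ≤_) |U|≡d (2[b+c∸1]/3≤ 1≤b grid-bound)
  where
  1≤b = ≤-trans 1≤a a≤b
  1≤c = ≤-trans 1≤b b≤c
  separating : Separating (proj₂ ∘ lookup U)
  separating = resolving⇒layer-separating (fromℕ< 1≤a) resolving
  grid-bound : 2 * (b + c) ≤ 3 * length U + 4
  grid-bound = Grid.2[b+c]≤3d+4 (proj₂ ∘ lookup U) separating (fromℕ< 1≤b) (fromℕ< 1≤c)
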